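{- Let $G$ be a graph on $n$ vertices and $q\ge 0$. It is possible to delete at most $qn^2$ edges from $G$ to obtain a subgraph all of whose connected components are $q$-cut-dense.
   Context: A graph $F$ is $q$-cut-dense if for every partition $V(F)=A\cup B$ we have $e_F(A,B)\ge q|A||B|$, where $e_F(A,B)$ is the number of edges of $F$ with one endpoint in $A$ and the other in $B$.
   Formalization: The parameter q ranges over the nonnegative rationals. -}

module Defs where

open import Data.Nat using (ℕ; _<ᵇ_) renaming (_*_ to _ℕ*_)
open import Data.Bool using (Bool; true; false; _∧_; if_then_else_)
open import Data.Fin using (Fin; toℕ)
open import Data.List using (map; allFin)
open import Data.Nat.ListAction using (sum)
open import Data.Vec using (lookup)
open import Data.Fin.Subset using (Subset; _∈_; _∉_; ∣_∣)
open import Data.Sum using (_⊎_)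
open import Data.Product using (_×_)
open import Relation.Binary.PropositionalEquality using (_≡_)
open import Relation.Nullary using (¬_)
open import Data.Integer using (+_)
open import Data.Rational using (ℚ; _≤_; _*_; _-_; _/_)

record Graph (n : ℕ) : Set where
  field
    adj    : Fin n → Fin n → Bool
    sym    : ∀ i j → adj i j ≡ adj j i
    irrefl : ∀ i → adj i i ≡ false
open Graph public

count : {n : ℕ} → (Fin n → Bool) → ℕ
count {n} p = sum (map (λ x → if p x then 1 else 0) (allFin n))

numEdges : {n : ℕ} → Graph n → ℕ
numEdges G = sum (map (λ i → count (λ j → (toℕ i <ᵇ toℕ j) ∧ adj G i j)) (allFin _))

eBetween : {n : ℕ} → Graph n → Subset n → Subset n → ℕ
eBetween G A B =
  sum (map (λ a → count (λ b → lookup A a ∧ lookup B b ∧ adj G a b)) (allFin _))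

_⊆G_ : {n : ℕ} → Graph n → Graph n → Set
H ⊆G G = ∀ i j → adj H i j ≡ true → adj G i j ≡ true

data Reach {n : ℕ} (H : Graph n) (v : Fin n) : Fin n → Set where
  here : Reach H v v
  step : ∀ {u w} → Reach H v u → adj H u w ≡ true → Reach H v w

PartitionOfComponent : {n : ℕ} → Graph n → Fin n → Subset n → Subset n → Set
PartitionOfComponent H v A B =
  (∀ u → (u ∈ A ⊎ u ∈ B) → Reach H v u) ×
  (∀ u → Reach H v u → u ∈ A ⊎ u ∈ B) ×
  (∀ u → u ∈ A → u ∉ B)

ℕ→ℚ : ℕ → ℚ
ℕ→ℚ k = (+ k) / 1

-- every connected component of H (as an induced subgraph of H) is q-cut-dense:
-- for every partition C = A ∪ B of a component C, e_H(A,B) ≥ q |A| |B|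
-- (edges of H between A and B all lie inside the component C).
ComponentsCutDense : {n : ℕ} → ℚ → Graph n → Set
ComponentsCutDense q H =
  ∀ v A B → PartitionOfComponent H v A B →
    q * ℕ→ℚ (∣ A ∣ ℕ* ∣ B ∣) ≤ ℕ→ℚ (eBetween H A B)

-- Keep refining a partition of the vertex set, deleting the edges between its
-- parts. Whenever some component C of the surviving graph H has a cut (A , B)
-- with e_H(A,B) < q |A| |B|, split A off its part: this deletes e_H(A,B) edges
-- while separating |A| |B| new pairs of vertices, so "deleted edges ≤ q ·
-- separated pairs" is preserved. Each split separates a new pair, so after at
-- most n² splits no sparse cut is left, and the deleted edges number at most
-- q · n².
module Submission where

open import Defs
open import Data.Nat using (ℕ) renaming (_*_ to _ℕ*_)
open import Data.Rational using (ℚ; 0ℚ; _≤_; _*_; _-_)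
open import Data.Product using (Σ; _×_)

open import Algebra.Properties.AbelianGroup using (xyx⁻¹≈y)
open import Data.Bool using (Bool; true; false; T; not; _∧_; _∨_; if_then_else_)
open import Data.Bool.Properties using (T-≡; T-∧; T-∨) renaming (_≟_ to _≟ᵇ_)
open import Data.Empty using (⊥-elim)
open import Data.Fin using (Fin; zero; suc; toℕ)
open import Data.Fin.Properties using (all?)
open import Data.Fin.Subset using (Subset; _∈_; _∉_; ∣_∣)
open import Data.Fin.Subset.Properties using (_∈?_; anySubset?)
import Data.Integer as ℤ
import Data.Integer.Properties as ℤP
open import Data.List using (List; _∷_; []; map; allFin; tabulate)
open import Data.List.Properties using (map-tabulate; ∷-injectiveˡ; ∷-injectiveʳ)
  renaming (≡-dec to List-≡-dec)
import Data.Nat.ListAction as List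
open import Data.Nat.Coprimality using (1-coprimeTo) renaming (sym to Coprime-sym)
open import Data.Nat as ℕ using (zero; suc; _+_; _∸_; _<ᵇ_; z≤n)
open import Data.Nat.Induction using (<-wellFounded)
open import Induction.WellFounded using (Acc; acc)
import Data.Nat.Properties as ℕP
open import Data.Product using (_,_; proj₁; proj₂; ∃₂)
import Data.Rational as ℚ
import Data.Rational.Properties as ℚP
open import Data.Sum using (_⊎_; inj₁; inj₂)
open import Data.Unit using (tt)
open import Data.Vec as Vec using (lookup)
open import Data.Vec.Properties using ([]=⇒lookup; lookup⇒[]=)
open import Function using (_∘_; _$_; case_of_; flip; Equivalence)
open import Relation.Binary.Definitions using (DecidableEquality)
open import Relation.Binary.PropositionalEquality as ≡
  using (_≡_; _≢_; refl; trans; cong; cong₂; ≢-sym)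
open import Relation.Nullary using (¬_; Dec; yes; no; contradiction)
open import Relation.Nullary.Decidable
  using (⌊_⌋; map′; _×-dec_; _⊎-dec_; _→-dec_; ¬?; toWitness; fromWitness;
         toWitnessFalse; fromWitnessFalse; decidable-stable; T?)

open import Algebra.Properties.Semiring.Sum ℕP.+-*-semiring
  using (sum; sum-cong-≗; sum-replicate-zero; ∑-distrib-+; ∑-comm; *-distribˡ-sum; *-distribʳ-sum)

open Equivalence using (to; from)

ind : Bool → ℕ
ind b = if b then 1 else 0

ind-mono : ∀ {a b} → (T a → T b) → ind a ℕ.≤ ind b
ind-mono {false}         _   = z≤n
ind-mono {true} {true}   _   = ℕP.≤-refl
ind-mono {true} {false}  a⇒b = ⊥-elim (a⇒b tt)

ind-∨ : ∀ a b → ind (a ∨ b) ℕ.≤ ind a + ind b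
ind-∨ false b = ℕP.≤-refl
ind-∨ true  b = ℕP.m≤m+n 1 (ind b)

ind-∨-disjoint : ∀ {a b} → (T a → ¬ T b) → ind (a ∨ b) ≡ ind a + ind b
ind-∨-disjoint {false}          _        = refl
ind-∨-disjoint {true}  {false}  _        = refl
ind-∨-disjoint {true}  {true}   disjoint = ⊥-elim (disjoint tt tt)

ind-∧ : ∀ a b → ind (a ∧ b) ≡ ind a ℕ* ind b
ind-∧ false b = refl
ind-∧ true  b = ≡.sym (ℕP.+-identityʳ (ind b))

sum-mono : ∀ {n} {f g : Fin n → ℕ} → (∀ i → f i ℕ.≤ g i) → sum f ℕ.≤ sum g
sum-mono {zero}  _   = z≤n
sum-mono {suc n} f≤g = ℕP.+-mono-≤ (f≤g zero) (sum-mono (f≤g ∘ suc))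

sum-const-1 : ∀ n → sum {n} (λ _ → 1) ≡ n
sum-const-1 zero    = refl
sum-const-1 (suc n) = cong suc (sum-const-1 n)

sum-tabulate : ∀ {n} (f : Fin n → ℕ) → List.sum (tabulate f) ≡ sum f
sum-tabulate {zero}  f = refl
sum-tabulate {suc n} f = cong (f zero +_) (sum-tabulate (f ∘ suc))

sum-map-allFin : ∀ {n} (f : Fin n → ℕ) → List.sum (map f (allFin n)) ≡ sum f
sum-map-allFin f = trans (cong List.sum (map-tabulate (λ i → i) f)) (sum-tabulate f)

count≡sum : ∀ {n} (p : Fin n → Bool) → count p ≡ sum (ind ∘ p)
count≡sum p = sum-map-allFin (ind ∘ p)

∣∣≡sum : ∀ {n} (A : Subset n) → ∣ A ∣ ≡ sum (ind ∘ lookup A)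
∣∣≡sum Vec.[]          = refl
∣∣≡sum (true  Vec.∷ A) = cong suc (∣∣≡sum A)
∣∣≡sum (false Vec.∷ A) = ∣∣≡sum A

BRel : ℕ → Set
BRel n = Fin n → Fin n → Bool

_∨ᵣ_ : ∀ {n} → BRel n → BRel n → BRel n
(R ∨ᵣ S) i j = R i j ∨ S i j

pairs : ∀ {n} → BRel n → ℕ
pairs R = sum λ i → sum λ j → ind (R i j)

pairs-mono : ∀ {n} {R S : BRel n} → (∀ i j → T (R i j) → T (S i j)) → pairs R ℕ.≤ pairs S
pairs-mono R⇒S = sum-mono λ i → sum-mono λ j → ind-mono (R⇒S i j)

pairs-∨ : ∀ {n} (R S : BRel n) → pairs (R ∨ᵣ S) ℕ.≤ pairs R + pairs S
pairs-∨ {n} R S = ℕP.≤-trans (sum-mono λ i → sum-mono λ j → ind-∨ (R i j) (S i j))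
  (ℕP.≤-reflexive (trans (sum-cong-≗ {n} λ i → ∑-distrib-+ (ind ∘ R i) (ind ∘ S i))
                         (∑-distrib-+ (λ i → sum (ind ∘ R i)) (λ i → sum (ind ∘ S i)))))

pairs-∨-disjoint : ∀ {n} {R S : BRel n} → (∀ i j → T (R i j) → ¬ T (S i j)) →
                   pairs (R ∨ᵣ S) ≡ pairs R + pairs S
pairs-∨-disjoint {n} {R} {S} disjoint =
  trans (sum-cong-≗ {n} λ i → trans (sum-cong-≗ {n} λ j → ind-∨-disjoint (disjoint i j))
                                (∑-distrib-+ (ind ∘ R i) (ind ∘ S i)))
        (∑-distrib-+ (λ i → sum (ind ∘ R i)) (λ i → sum (ind ∘ S i)))

pairs-flip : ∀ {n} (R : BRel n) → pairs (flip R) ≡ pairs R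
pairs-flip R = ∑-comm λ j i → ind (R i j)

pairs-× : ∀ {n} (a b : Fin n → Bool) →
          pairs (λ i j → a i ∧ b j) ≡ sum (ind ∘ a) ℕ* sum (ind ∘ b)
pairs-× {n} a b = begin
  pairs (λ i j → a i ∧ b j)                       ≡⟨ sum-cong-≗ {n} (λ i → sum-cong-≗ {n} λ j → ind-∧ (a i) (b j)) ⟩
  sum (λ i → sum λ j → ind (a i) ℕ* ind (b j))    ≡⟨ sum-cong-≗ {n} (λ i → *-distribˡ-sum (ind (a i)) (ind ∘ b)) ⟨
  sum (λ i → ind (a i) ℕ* sum (ind ∘ b))          ≡⟨ *-distribʳ-sum (sum (ind ∘ b)) (ind ∘ a) ⟨
  sum (ind ∘ a) ℕ* sum (ind ∘ b)                  ∎
  where open ≡.≡-Reasoning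

pairs≤n² : ∀ {n} (R : BRel n) → pairs R ℕ.≤ n ℕ* n
pairs≤n² {n} R = ℕP.≤-trans (pairs-mono {n} {R} {λ _ _ → true} λ _ _ _ → tt)
  (ℕP.≤-reflexive (trans (pairs-× {n} (λ _ → true) (λ _ → true))
                         (cong₂ _ℕ*_ (sum-const-1 n) (sum-const-1 n))))

pairs-false : ∀ {n} → pairs {n} (λ _ _ → false) ≡ 0
pairs-false {n} = trans (sum-cong-≗ {n} λ _ → sum-replicate-zero n) (sum-replicate-zero n)

numEdges≡pairs : ∀ {n} (G : Graph n) → numEdges G ≡ pairs (λ i j → (toℕ i <ᵇ toℕ j) ∧ adj G i j)
numEdges≡pairs {n} G = trans (sum-map-allFin {n} _) (sum-cong-≗ {n} λ i → count≡sum {n} _)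

eBetween≡pairs : ∀ {n} (G : Graph n) A B →
                 eBetween G A B ≡ pairs (λ a b → lookup A a ∧ lookup B b ∧ adj G a b)
eBetween≡pairs {n} G A B = trans (sum-map-allFin {n} _) (sum-cong-≗ {n} λ a → count≡sum {n} _)

numEdges-≤-+ : ∀ {n} (G H : Graph n) (R : BRel n) →
               (∀ i j → T (adj G i j) → T (adj H i j ∨ R i j)) →
               numEdges G ℕ.≤ numEdges H + pairs R
numEdges-≤-+ G H R G⇒H∨R = begin
  numEdges G                                          ≡⟨ numEdges≡pairs G ⟩
  pairs (λ i j → (toℕ i <ᵇ toℕ j) ∧ adj G i j)        ≤⟨ pairs-mono (λ i j → ordered-edge (toℕ i <ᵇ toℕ j) (G⇒H∨R i j)) ⟩
  pairs ((λ i j → (toℕ i <ᵇ toℕ j) ∧ adj H i j) ∨ᵣ R) ≤⟨ pairs-∨ _ R ⟩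
  pairs (λ i j → (toℕ i <ᵇ toℕ j) ∧ adj H i j) + pairs R ≡⟨ cong (_+ pairs R) (numEdges≡pairs H) ⟨
  numEdges H + pairs R                                ∎
  where
  open ℕP.≤-Reasoning
  ordered-edge : ∀ c {g h r} → (T g → T (h ∨ r)) → T (c ∧ g) → T (c ∧ h ∨ r)
  ordered-edge true  g⇒h∨r = g⇒h∨r

ℕ→ℚ≡mkℚ : ∀ k → ℕ→ℚ k ≡ ℚ.mkℚ (ℤ.+ k) 0 (Coprime-sym (1-coprimeTo k))
ℕ→ℚ≡mkℚ k = ℚP.normalize-coprime (Coprime-sym (1-coprimeTo k))

ℕ→ℚ-mono : ∀ {a b} → a ℕ.≤ b → ℕ→ℚ a ≤ ℕ→ℚ b
ℕ→ℚ-mono {a} {b} a≤b rewrite ℕ→ℚ≡mkℚ a | ℕ→ℚ≡mkℚ b =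
  ℚ.*≤* (ℤP.*-monoʳ-≤-nonNeg (ℤ.+ 1) (ℤ.+≤+ a≤b))

ℕ→ℚ-+ : ∀ a b → ℕ→ℚ (a + b) ≡ ℕ→ℚ a ℚ.+ ℕ→ℚ b
ℕ→ℚ-+ a b rewrite ℕ→ℚ≡mkℚ a | ℕ→ℚ≡mkℚ b =
  ℚP./-cong (trans (ℤP.pos-+ a b)
                   (≡.sym (cong₂ ℤ._+_ (ℤP.*-identityʳ (ℤ.+ a)) (ℤP.*-identityʳ (ℤ.+ b)))))
            refl

record Dominated (q : ℚ) (a s : ℕ) : Set where
  constructor dominated
  field
    ℕ→ℚ≤q* : ℕ→ℚ a ≤ q * ℕ→ℚ s

module _ {q : ℚ} (0≤q : 0ℚ ≤ q) where

  dominated-mono : ∀ {a a′ s s′} → a′ ℕ.≤ a → s ℕ.≤ s′ → Dominated q a s → Dominated q a′ s′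
  dominated-mono a′≤a s≤s′ (dominated a≤qs) = dominated $ ℚP.≤-trans (ℕ→ℚ-mono a′≤a)
    (ℚP.≤-trans a≤qs (ℚP.*-monoˡ-≤-nonNeg q {{ℚ.nonNegative 0≤q}} (ℕ→ℚ-mono s≤s′)))

  dominated-zero : ∀ s → Dominated q 0 s
  dominated-zero s = dominated $ ≡.subst (_≤ q * ℕ→ℚ s) (ℚP.*-zeroʳ q)
    (ℚP.*-monoˡ-≤-nonNeg q {{ℚ.nonNegative 0≤q}} (ℕ→ℚ-mono {0} {s} z≤n))

dominated-+ : ∀ {q a b s t} → Dominated q a s → Dominated q b t → Dominated q (a + b) (s + t)
dominated-+ {q} {a} {b} {s} {t} (dominated a≤qs) (dominated b≤qt) = dominated $ begin
  ℕ→ℚ (a + b)                    ≡⟨ ℕ→ℚ-+ a b ⟩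
  ℕ→ℚ a ℚ.+ ℕ→ℚ b                ≤⟨ ℚP.+-mono-≤ a≤qs b≤qt ⟩
  q * ℕ→ℚ s ℚ.+ q * ℕ→ℚ t        ≡⟨ ℚP.*-distribˡ-+ q (ℕ→ℚ s) (ℕ→ℚ t) ⟨
  q * (ℕ→ℚ s ℚ.+ ℕ→ℚ t)          ≡⟨ cong (q *_) (ℕ→ℚ-+ s t) ⟨
  q * ℕ→ℚ (s + t)                ∎
  where open ℚP.≤-Reasoning

ℕ→ℚ-difference≤ : ∀ {g h d} {x : ℚ} → g ℕ.≤ h + d → ℕ→ℚ d ≤ x → ℕ→ℚ g - ℕ→ℚ h ≤ x
ℕ→ℚ-difference≤ {g} {h} {d} {x} g≤h+d d≤x = begin
  ℕ→ℚ g - ℕ→ℚ h                  ≤⟨ ℚP.+-monoˡ-≤ (ℚ.- ℕ→ℚ h) (ℕ→ℚ-mono g≤h+d) ⟩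
  ℕ→ℚ (h + d) - ℕ→ℚ h            ≡⟨ cong (ℚ._- ℕ→ℚ h) (ℕ→ℚ-+ h d) ⟩
  ℕ→ℚ h ℚ.+ ℕ→ℚ d - ℕ→ℚ h        ≡⟨ xyx⁻¹≈y ℚP.+-0-abelianGroup (ℕ→ℚ h) (ℕ→ℚ d) ⟩
  ℕ→ℚ d                          ≤⟨ d≤x ⟩
  x                              ∎
  where open ℚP.≤-Reasoning

-- Labellings: partitions of the vertex set

-- A label lists the sides of all the splits a vertex has gone through, so a
-- split never has to invent a fresh label.
Label : Set
Label = List Bool

_≟ₗ_ : DecidableEquality Label
_≟ₗ_ = List-≡-dec _≟ᵇ_

_==ₗ_ : Label → Label → Bool
x ==ₗ y = ⌊ x ≟ₗ y ⌋

==ₗ⇒≡ : ∀ {x y} → T (x ==ₗ y) → x ≡ y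
==ₗ⇒≡ {x} {y} = toWitness {a? = x ≟ₗ y}

≡⇒==ₗ : ∀ {x y} → x ≡ y → T (x ==ₗ y)
≡⇒==ₗ {x} {y} = fromWitness {a? = x ≟ₗ y}

not-==ₗ⇒≢ : ∀ {x y} → T (not (x ==ₗ y)) → x ≢ y
not-==ₗ⇒≢ {x} {y} = toWitnessFalse {a? = x ≟ₗ y}

≢⇒not-==ₗ : ∀ {x y} → x ≢ y → T (not (x ==ₗ y))
≢⇒not-==ₗ {x} {y} = fromWitnessFalse {a? = x ≟ₗ y}

==ₗ-comm : ∀ x y → (x ==ₗ y) ≡ (y ==ₗ x)
==ₗ-comm x y with x ≟ₗ y | y ≟ₗ x
... | yes _   | yes _   = refl
... | no  _   | no  _   = refl
... | yes x≡y | no  y≢x = contradiction (≡.sym x≡y) y≢x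
... | no  x≢y | yes y≡x = contradiction (≡.sym y≡x) x≢y

Labelling : ℕ → Set
Labelling n = Fin n → Label

module _ {n : ℕ} where

  sameLabel : Labelling n → BRel n
  sameLabel L i j = L i ==ₗ L j

  separated : Labelling n → BRel n
  separated L i j = not (sameLabel L i j)

  split : Labelling n → Subset n → Labelling n
  split L A u = lookup A u ∷ L u

  separated-split : ∀ L A {i j} → T (separated L i j) → T (separated (split L A) i j)
  separated-split L A sep = ≢⇒not-==ₗ (not-==ₗ⇒≢ sep ∘ ∷-injectiveʳ)

  split-separates : ∀ L A {i j} → lookup A i ≢ lookup A j → T (separated (split L A) i j)
  split-separates L A ne = ≢⇒not-==ₗ (ne ∘ ∷-injectiveˡ)

  within : Graph n → Labelling n → Graph n
  within G L = record
    { adj    = λ i j → adj G i j ∧ sameLabel L i j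
    ; sym    = λ i j → cong₂ _∧_ (sym G i j) (==ₗ-comm (L i) (L j))
    ; irrefl = λ i → cong (_∧ sameLabel L i i) (irrefl G i)
    }

  within-⊆ : ∀ G L → within G L ⊆G G
  within-⊆ G L i j kept = to T-≡ (proj₁ (to (T-∧ {adj G i j}) (from T-≡ kept)))

  cutEdges : Graph n → Labelling n → BRel n
  cutEdges G L i j = adj G i j ∧ separated L i j

  numEdges-within : ∀ G L → numEdges G ℕ.≤ numEdges (within G L) + pairs (cutEdges G L)
  numEdges-within G L = numEdges-≤-+ G (within G L) (cutEdges G L) λ i j → kept-or-cut (adj G i j) (sameLabel L i j)
    where
    kept-or-cut : ∀ g s → T g → T (g ∧ s ∨ g ∧ not s)
    kept-or-cut true true  _ = tt
    kept-or-cut true false _ = tt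

  reach⇒sameLabel : ∀ {G L v u} → Reach (within G L) v u → L v ≡ L u
  reach⇒sameLabel here          = refl
  reach⇒sameLabel (step v⇝u uw) =
    trans (reach⇒sameLabel v⇝u) (==ₗ⇒≡ (proj₂ (to T-∧ (from T-≡ uw))))

∈⇒T : ∀ {n u} {A : Subset n} → u ∈ A → T (lookup A u)
∈⇒T u∈A = from T-≡ ([]=⇒lookup u∈A)

T⇒∈ : ∀ {n u} {A : Subset n} → T (lookup A u) → u ∈ A
T⇒∈ {u = u} {A} t = lookup⇒[]= u A (to T-≡ t)

∉⇒lookup≡false : ∀ {n u} (A : Subset n) → u ∉ A → lookup A u ≡ false
∉⇒lookup≡false {u = u} A u∉A with lookup A u in eq
... | true  = contradiction (lookup⇒[]= u A eq) u∉A
... | false = refl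

∈∉⇒lookup≢ : ∀ {n i j} {A : Subset n} → i ∈ A → j ∉ A → lookup A i ≢ lookup A j
∈∉⇒lookup≢ {j = j} {A} i∈A j∉A eq = j∉A (lookup⇒[]= j A (trans (≡.sym eq) ([]=⇒lookup i∈A)))

-- Refining a labelling along sparse cuts

module Refinement {n : ℕ} (G : Graph n) {q : ℚ} (0≤q : 0ℚ ≤ q) where

  -- A ∪ B need not be a whole component of within G L, only closed under its
  -- edges and inside one label class; this keeps SparseCut decidable.
  record SparseCut (L : Labelling n) (A B : Subset n) : Set where
    constructor sparseCut
    field
      disjoint      : ∀ u → u ∈ A → u ∉ B
      monochromatic : ∀ u w → u ∈ A ⊎ u ∈ B → w ∈ A ⊎ w ∈ B → L u ≡ L w
      closed        : ∀ u w → u ∈ A ⊎ u ∈ B → T (adj (within G L) u w) → w ∈ A ⊎ w ∈ B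
      sparse        : ¬ (q * ℕ→ℚ (∣ A ∣ ℕ* ∣ B ∣) ≤ ℕ→ℚ (eBetween (within G L) A B))

  sparseCut? : ∀ L A B → Dec (SparseCut L A B)
  sparseCut? L A B =
    map′ (λ (d , m , c , s) → sparseCut d m c s)
         (λ S → SparseCut.disjoint S , SparseCut.monochromatic S , SparseCut.closed S , SparseCut.sparse S)
         (all? (λ u → u ∈? A →-dec ¬? (u ∈? B)) ×-dec
          all? (λ u → all? λ w → inside? u →-dec inside? w →-dec L u ≟ₗ L w) ×-dec
          all? (λ u → all? λ w → inside? u →-dec T? (adj (within G L) u w) →-dec inside? w) ×-dec
          ¬? (q * ℕ→ℚ (∣ A ∣ ℕ* ∣ B ∣) ℚP.≤? ℕ→ℚ (eBetween (within G L) A B)))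
    where
    inside? : ∀ u → Dec (u ∈ A ⊎ u ∈ B)
    inside? u = u ∈? A ⊎-dec u ∈? B

  anySparseCut? : ∀ L → Dec (∃₂ (SparseCut L))
  anySparseCut? L = anySubset? λ A → anySubset? λ B → sparseCut? L A B

  noSparseCut⇒componentsCutDense : ∀ L → (∀ A B → ¬ SparseCut L A B) →
                                   ComponentsCutDense q (within G L)
  noSparseCut⇒componentsCutDense L noCut v A B (inComponent , covers , disjoint) =
    decidable-stable (_ ℚP.≤? _) λ notDense → noCut A B (sparseCut disjoint monochromatic closed notDense)
    where
    monochromatic : ∀ u w → u ∈ A ⊎ u ∈ B → w ∈ A ⊎ w ∈ B → L u ≡ L w
    monochromatic u w u∈C w∈C =
      trans (≡.sym (reach⇒sameLabel (inComponent u u∈C))) (reach⇒sameLabel (inComponent w w∈C))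
    closed : ∀ u w → u ∈ A ⊎ u ∈ B → T (adj (within G L) u w) → w ∈ A ⊎ w ∈ B
    closed u w u∈C uw = covers w (step (inComponent u u∈C) (to T-≡ uw))

  FewCutEdges : Labelling n → Set
  FewCutEdges L = Dominated q (pairs (cutEdges G L)) (pairs (separated L))

  module Split {L : Labelling n} {A B : Subset n} (cut : SparseCut L A B) where
    open SparseCut cut

    H : Graph n
    H = within G L

    L′ : Labelling n
    L′ = split L A

    e m : ℕ
    e = eBetween H A B
    m = ∣ A ∣ ℕ* ∣ B ∣

    AB crossing : BRel n
    AB i j       = lookup A i ∧ lookup B j
    crossing i j = lookup A i ∧ lookup B j ∧ adj H i j

    ∈B⇒∉A : ∀ {u} → u ∈ B → u ∉ A
    ∈B⇒∉A u∈B u∈A = disjoint _ u∈A u∈B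

    separated-or-across : ∀ i j → T ((separated L ∨ᵣ (AB ∨ᵣ flip AB)) i j) → T (separated L′ i j)
    separated-or-across i j h with to (T-∨ {separated L i j}) h
    ... | inj₁ sep = separated-split L A sep
    ... | inj₂ across with to (T-∨ {AB i j}) across
    ...   | inj₁ ab = let i∈A , j∈B = to T-∧ ab in
      split-separates L A (∈∉⇒lookup≢ (T⇒∈ i∈A) (∈B⇒∉A (T⇒∈ j∈B)))
    ...   | inj₂ ba = let j∈A , i∈B = to T-∧ ba in
      split-separates L A (≢-sym (∈∉⇒lookup≢ (T⇒∈ j∈A) (∈B⇒∉A (T⇒∈ i∈B))))

    across-sameLabel : ∀ i j → T (AB i j) → L i ≡ L j
    across-sameLabel i j ab = let i∈A , j∈B = to T-∧ ab in
      monochromatic i j (inj₁ (T⇒∈ i∈A)) (inj₂ (T⇒∈ j∈B))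

    separated-not-across : ∀ i j → T (separated L i j) → ¬ T ((AB ∨ᵣ flip AB) i j)
    separated-not-across i j sep across with to (T-∨ {AB i j}) across
    ... | inj₁ ab = not-==ₗ⇒≢ sep (across-sameLabel i j ab)
    ... | inj₂ ba = not-==ₗ⇒≢ sep (≡.sym (across-sameLabel j i ba))

    AB-not-flipped : ∀ i j → T (AB i j) → ¬ T (AB j i)
    AB-not-flipped i j ab ba = disjoint i (T⇒∈ (proj₁ (to T-∧ ab))) (T⇒∈ (proj₂ (to T-∧ ba)))

    pairs-AB : pairs AB ≡ m
    pairs-AB = trans (pairs-× (lookup A) (lookup B)) (≡.sym (cong₂ _ℕ*_ (∣∣≡sum A) (∣∣≡sum B)))

    separation-growth : pairs (separated L) + (m + m) ℕ.≤ pairs (separated L′)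
    separation-growth = begin
      pairs (separated L) + (m + m)                           ≡⟨ cong (pairs (separated L) +_)
                                                                   (cong₂ _+_ pairs-AB (trans (pairs-flip AB) pairs-AB)) ⟨
      pairs (separated L) + (pairs AB + pairs (flip AB))      ≡⟨ cong (pairs (separated L) +_) (pairs-∨-disjoint AB-not-flipped) ⟨
      pairs (separated L) + pairs (AB ∨ᵣ flip AB)             ≡⟨ pairs-∨-disjoint separated-not-across ⟨
      pairs (separated L ∨ᵣ (AB ∨ᵣ flip AB))                  ≤⟨ pairs-mono separated-or-across ⟩
      pairs (separated L′)                                    ∎
      where open ℕP.≤-Reasoning

    leaves-A : ∀ {u w} → u ∈ A → w ∉ A → T (adj H u w) → T (crossing u w)
    leaves-A {u} {w} u∈A w∉A uw with closed u w (inj₁ u∈A) uw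
    ... | inj₁ w∈A = contradiction w∈A w∉A
    ... | inj₂ w∈B = from T-∧ (∈⇒T u∈A , from T-∧ (∈⇒T w∈B , uw))

    crosses : ∀ i j → lookup A i ≢ lookup A j → T (adj H i j) → T ((crossing ∨ᵣ flip crossing) i j)
    crosses i j differ ij with i ∈? A | j ∈? A
    ... | yes i∈A | yes j∈A = contradiction (trans ([]=⇒lookup i∈A) (≡.sym ([]=⇒lookup j∈A))) differ
    ... | yes i∈A | no  j∉A = from (T-∨ {crossing i j}) (inj₁ (leaves-A i∈A j∉A ij))
    ... | no  i∉A | yes j∈A = from (T-∨ {crossing i j}) (inj₂ (leaves-A j∈A i∉A (≡.subst T (sym H i j) ij)))
    ... | no  i∉A | no  j∉A = contradiction (trans (∉⇒lookup≡false A i∉A) (≡.sym (∉⇒lookup≡false A j∉A))) differ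

    cut-or-crossing : ∀ i j → T (cutEdges G L′ i j) → T ((cutEdges G L ∨ᵣ (crossing ∨ᵣ flip crossing)) i j)
    cut-or-crossing i j h with to (T-∧ {adj G i j}) h | T? (sameLabel L i j)
    ... | ij , _    | no  different =
      from (T-∨ {cutEdges G L i j}) (inj₁ (from T-∧ (ij , ≢⇒not-==ₗ (different ∘ ≡⇒==ₗ))))
    ... | ij , sep′ | yes same      = from (T-∨ {cutEdges G L i j}) (inj₂ (crosses i j
          (λ Ai≡Aj → not-==ₗ⇒≢ sep′ (cong₂ _∷_ Ai≡Aj (==ₗ⇒≡ same)))
          (from T-∧ (ij , same))))

    pairs-crossing : pairs crossing ≡ e
    pairs-crossing = ≡.sym (eBetween≡pairs H A B)

    cut-growth : pairs (cutEdges G L′) ℕ.≤ pairs (cutEdges G L) + (e + e)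
    cut-growth = begin
      pairs (cutEdges G L′)                                          ≤⟨ pairs-mono cut-or-crossing ⟩
      pairs (cutEdges G L ∨ᵣ (crossing ∨ᵣ flip crossing))            ≤⟨ pairs-∨ (cutEdges G L) (crossing ∨ᵣ flip crossing) ⟩
      pairs (cutEdges G L) + pairs (crossing ∨ᵣ flip crossing)       ≤⟨ ℕP.+-monoʳ-≤ (pairs (cutEdges G L)) (pairs-∨ crossing (flip crossing)) ⟩
      pairs (cutEdges G L) + (pairs crossing + pairs (flip crossing)) ≡⟨ cong (pairs (cutEdges G L) +_)
                                                                          (cong₂ _+_ pairs-crossing (trans (pairs-flip crossing) pairs-crossing)) ⟩
      pairs (cutEdges G L) + (e + e)                                 ∎
      where open ℕP.≤-Reasoning

    sparse⇒dominated : Dominated q e m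
    sparse⇒dominated = dominated $ ℚP.<⇒≤ (ℚP.≰⇒> sparse)

    m>0 : 0 ℕ.< m
    m>0 = ℕP.n≢0⇒n>0 λ m≡0 → sparse (begin
      q * ℕ→ℚ m   ≡⟨ cong (λ k → q * ℕ→ℚ k) m≡0 ⟩
      q * 0ℚ      ≡⟨ ℚP.*-zeroʳ q ⟩
      0ℚ          ≤⟨ ℕ→ℚ-mono {0} {e} z≤n ⟩
      ℕ→ℚ e       ∎)
      where open ℚP.≤-Reasoning

    separated-grows : pairs (separated L) ℕ.< pairs (separated L′)
    separated-grows = ℕP.<-≤-trans (ℕP.m<m+n _ (ℕP.<-≤-trans m>0 (ℕP.m≤m+n m m))) separation-growth

    fewCutEdges-split : FewCutEdges L → FewCutEdges L′
    fewCutEdges-split inv = dominated-mono 0≤q cut-growth separation-growth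
      (dominated-+ inv (dominated-+ sparse⇒dominated sparse⇒dominated))

  Refined : Set
  Refined = Σ (Labelling n) λ L → FewCutEdges L × (∀ A B → ¬ SparseCut L A B)

  refine : ∀ L → Acc ℕ._<_ (n ℕ* n ∸ pairs (separated L)) → FewCutEdges L → Refined
  refine L (acc smaller) inv = continue (anySparseCut? L)
    where
    continue : Dec (∃₂ (SparseCut L)) → Refined
    continue (no  noCut)         = L , inv , λ A B cut → noCut (A , B , cut)
    continue (yes (A , B , cut)) = refine L′ (smaller potential-drops) (fewCutEdges-split inv)
      where
      open Split cut
      potential-drops : n ℕ* n ∸ pairs (separated L′) ℕ.< n ℕ* n ∸ pairs (separated L)
      potential-drops = ℕP.∸-monoʳ-< separated-grows (pairs≤n² (separated L′))

  unlabelled : Labelling n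
  unlabelled _ = []

  fewCutEdges-unlabelled : FewCutEdges unlabelled
  fewCutEdges-unlabelled = dominated-mono 0≤q no-cut-edges ℕP.≤-refl (dominated-zero 0≤q _)
    where
    no-cut-edges : pairs (cutEdges G unlabelled) ℕ.≤ 0
    no-cut-edges = ℕP.≤-trans (pairs-mono {S = λ _ _ → false} λ i j cut → proj₂ (to (T-∧ {adj G i j}) cut))
                              (ℕP.≤-reflexive (pairs-false {n}))

  deleted-edges-bound : ∀ L → FewCutEdges L →
                        ℕ→ℚ (numEdges G) - ℕ→ℚ (numEdges (within G L)) ≤ q * ℕ→ℚ (n ℕ* n)
  deleted-edges-bound L inv =
    ℕ→ℚ-difference≤ {h = numEdges (within G L)} {d = pairs (cutEdges G L)} (numEdges-within G L)
    (Dominated.ℕ→ℚ≤q* (dominated-mono 0≤q ℕP.≤-refl (pairs≤n² (separated L)) inv))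

  refined : Refined
  refined = refine unlabelled (<-wellFounded _) fewCutEdges-unlabelled

lemma3p13 : (n : ℕ) (G : Graph n) (q : ℚ) → 0ℚ ≤ q →
    Σ (Graph n) (λ H → (H ⊆G G) ×
      (ℕ→ℚ (numEdges G) - ℕ→ℚ (numEdges H) ≤ q * ℕ→ℚ (n ℕ* n)) ×
      ComponentsCutDense q H)
lemma3p13 n G q 0≤q = case refined of λ (L , inv , noCut) →
  within G L , within-⊆ G L , deleted-edges-bound L inv , noSparseCut⇒componentsCutDense L noCut
  where open Refinement G 0≤q
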